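{- Let $N \ge 1$, let $G_N$ be the divisibility graph on $X_N=\{1,\dots,N\}$, and let $n \in X_N$ have degree $k_n$. Then the mean geodesic distance of $n$ is $$l_n = \frac{2N - k_n - 2}{N}.$$
   Context: The divisibility graph $G_N$ is the simple undirected graph with vertex set $X_N=\{1,\dots,N\}$, in which two distinct vertices $i \ne j$ are adjacent if and only if $i$ divides $j$ or $j$ divides $i$ (no loops). The degree $k_n$ is the number of vertices adjacent to $n$. For vertices $n,m$, $d_{nm}$ is the length of a shortest path between $n$ and $m$ (so $d_{nn}=0$). The mean geodesic distance of $n$ is $l_n = \frac{1}{N}\sum_{m \in X_N} d_{nm}$. -}

module Defs where

open import Data.Nat using (ℕ; zero; suc; _≤_; NonZero)
import Data.Nat
open import Data.Nat.Divisibility using (_∣_; _∣?_)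
open import Data.Nat.Properties using (_≟_)
open import Data.List using (List; map; filter; length; upTo)
open import Data.Nat.ListAction using (sum)
open import Data.Product using (_×_)
open import Data.Sum using (_⊎_)
open import Relation.Nullary using (¬_; Dec)
open import Relation.Nullary.Decidable using (_×-dec_; _⊎-dec_; ¬?)
open import Relation.Binary.PropositionalEquality using (_≡_; _≢_)
open import Data.Integer using (ℤ; +_; _-_)
open import Data.Rational using (ℚ; _/_)

X : ℕ → List ℕ
X N = map suc (upTo N)

-- Adjacency in the divisibility graph (for vertices already known to lie in X_N):
-- distinct and one divides the other (no loops).
DivAdj : ℕ → ℕ → Set
DivAdj a b = (a ≢ b) × (a ∣ b ⊎ b ∣ a)

divAdj? : ∀ a b → Dec (DivAdj a b)
divAdj? a b = ¬? (a ≟ b) ×-dec ((a ∣? b) ⊎-dec (b ∣? a))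

Adj : ℕ → ℕ → ℕ → Set
Adj N a b = (1 ≤ a × a ≤ N) × (1 ≤ b × b ≤ N) × DivAdj a b

degree : ℕ → ℕ → ℕ
degree N n = length (filter (divAdj? n) (X N))

data Walk (N : ℕ) : ℕ → ℕ → ℕ → Set where
  here : ∀ {a} → 1 ≤ a → a ≤ N → Walk N a a 0
  step : ∀ {a b c l} → Adj N a b → Walk N b c l → Walk N a c (suc l)

IsGeodesicDist : (N n : ℕ) → (ℕ → ℕ) → Set
IsGeodesicDist N n d =
  ∀ m → 1 ≤ m → m ≤ N → Walk N n m (d m) × (∀ l → Walk N n m l → d m ≤ l)

meanDist : (N : ℕ) .{{_ : NonZero N}} → (ℕ → ℕ) → ℚ
meanDist N d = (+ sum (map d (X N))) / N

formula : (N : ℕ) .{{_ : NonZero N}} → ℕ → ℚ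
formula N n = ((+ (2 Data.Nat.* N) - + degree N n) - + 2) / N

-- Every vertex of G_N other than 1 is adjacent to 1, so the distance from n to m is 0 if m = n,
-- 1 if m is a neighbour of n, and 2 otherwise (a path n — 1 — m).  Hence
-- d_{nm} + [m ~ n] + 2[m = n] = 2 for every m, and summing over X_N gives
-- Σ_m d_{nm} + k_n + 2 = 2N.
module Submission where

open import Defs
open import Data.Nat using (ℕ; zero; suc; _+_; _*_; _≤_; _<_; z≤n; s≤s; NonZero)
open import Data.Nat.Properties using (_≟_; ≤-antisym; ≤-trans; ≤-refl; n≤1+n; <-irrefl; m≤n⇒m<n∨m≡n; <⇒≢; >⇒≢; *-suc)
open import Data.Nat.Divisibility using (1∣_)
open import Data.Nat.ListAction using (sum)
open import Data.Nat.Tactic.RingSolver using (solve-∀)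
open import Data.List using (List; []; _∷_; _++_; [_]; map; filter; length; upTo)
open import Data.List.Properties using (map-++; upTo-∷ʳ; filter-++; filter-accept; filter-reject; length-++; length-map; length-upTo; map-cong-local)
open import Data.List.Relation.Unary.All as All using (All)
open import Data.List.Relation.Unary.All.Properties using (map⁺; all-upTo)
open import Data.Product using (_×_; ∃; _,_; proj₁; proj₂)
open import Data.Sum using (inj₁; inj₂)
open import Data.Empty using (⊥-elim)
open import Relation.Nullary using (yes; no)
open import Relation.Unary using (Decidable)
open import Relation.Binary.PropositionalEquality using (_≡_; _≢_; refl; sym; trans; cong; cong₂; module ≡-Reasoning)
open import Data.Integer using (+_; _-_) renaming (_+_ to _+ℤ_)
import Data.Integer.Tactic.RingSolver as ℤ
open import Data.Integer.Properties using (pos-+)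
open import Data.Rational using (_/_)

X-suc : ∀ N → X (suc N) ≡ X N ++ [ suc N ]
X-suc N = trans (cong (map suc) (sym (upTo-∷ʳ N))) (map-++ suc (upTo N) [ N ])

length-X : ∀ N → length (X N) ≡ N
length-X N = trans (length-map suc (upTo N)) (length-upTo N)

All-X : ∀ N → All (λ m → 1 ≤ m × m ≤ N) (X N)
All-X N = map⁺ (All.map (λ m<N → s≤s z≤n , m<N) (all-upTo N))

filter-≟-X-suc : ∀ N n → filter (_≟ n) (X (suc N)) ≡ filter (_≟ n) (X N) ++ filter (_≟ n) [ suc N ]
filter-≟-X-suc N n = trans (cong (filter (_≟ n)) (X-suc N)) (filter-++ (_≟ n) (X N) [ suc N ])

filter-≟-X-beyond : ∀ N {n} → N < n → filter (_≟ n) (X N) ≡ []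
filter-≟-X-beyond zero _ = refl
filter-≟-X-beyond (suc N) {n} N<n = begin
  filter (_≟ n) (X (suc N))
    ≡⟨ filter-≟-X-suc N n ⟩
  filter (_≟ n) (X N) ++ filter (_≟ n) [ suc N ]
    ≡⟨ cong₂ _++_ (filter-≟-X-beyond N (≤-trans (n≤1+n (suc N)) N<n)) (filter-reject (_≟ n) (<⇒≢ N<n)) ⟩
  [] ∎
  where open ≡-Reasoning

length-filter-≟-X : ∀ N {n} → 1 ≤ n → n ≤ N → length (filter (_≟ n) (X N)) ≡ 1
length-filter-≟-X zero (s≤s _) ()
length-filter-≟-X (suc N) {n} 1≤n n≤N with m≤n⇒m<n∨m≡n n≤N
... | inj₁ (s≤s n≤N′) = begin
  length (filter (_≟ n) (X (suc N)))
    ≡⟨ cong length (filter-≟-X-suc N n) ⟩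
  length (filter (_≟ n) (X N) ++ filter (_≟ n) [ suc N ])
    ≡⟨ length-++ (filter (_≟ n) (X N)) ⟩
  length (filter (_≟ n) (X N)) + length (filter (_≟ n) [ suc N ])
    ≡⟨ cong₂ _+_ (length-filter-≟-X N 1≤n n≤N′) (cong length (filter-reject (_≟ n) (>⇒≢ (s≤s n≤N′)))) ⟩
  1 ∎
  where open ≡-Reasoning
... | inj₂ refl = begin
  length (filter (_≟ suc N) (X (suc N)))
    ≡⟨ cong length (filter-≟-X-suc N (suc N)) ⟩
  length (filter (_≟ suc N) (X N) ++ filter (_≟ suc N) [ suc N ])
    ≡⟨ cong (λ xs → length (xs ++ filter (_≟ suc N) [ suc N ])) (filter-≟-X-beyond N ≤-refl) ⟩
  length (filter (_≟ suc N) [ suc N ])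
    ≡⟨ cong length (filter-accept (_≟ suc N) {xs = []} refl) ⟩
  1 ∎
  where open ≡-Reasoning

walk-length-0 : ∀ {N a b} → Walk N a b 0 → a ≡ b
walk-length-0 (here _ _) = refl

walk-length-1 : ∀ {N a b} → Walk N a b 1 → DivAdj a b
walk-length-1 (step (_ , _ , a~b) (here _ _)) = a~b

geodesic-unique : ∀ {N n d d′} → IsGeodesicDist N n d → IsGeodesicDist N n d′ →
                  ∀ {m} → 1 ≤ m → m ≤ N → d m ≡ d′ m
geodesic-unique g g′ {m} 1≤m m≤N =
  ≤-antisym (proj₂ (g m 1≤m m≤N) _ (proj₁ (g′ m 1≤m m≤N)))
            (proj₂ (g′ m 1≤m m≤N) _ (proj₁ (g m 1≤m m≤N)))

distFrom : ℕ → ℕ → ℕ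
distFrom n m with m ≟ n | divAdj? n m
... | yes _ | _     = 0
... | no _  | yes _ = 1
... | no _  | no _  = 2

distFrom-geodesic : ∀ {N n} → 1 ≤ n → n ≤ N → IsGeodesicDist N n (distFrom n)
distFrom-geodesic {N} {n} 1≤n n≤N m 1≤m m≤N with m ≟ n | divAdj? n m
... | yes refl | _ = here 1≤m m≤N , λ _ _ → z≤n
... | no m≢n | yes n~m = step (n∈X , m∈X , n~m) (here 1≤m m≤N) , at-least-1
  where
  n∈X : 1 ≤ n × n ≤ N
  n∈X = 1≤n , n≤N
  m∈X : 1 ≤ m × m ≤ N
  m∈X = 1≤m , m≤N
  at-least-1 : ∀ l → Walk N n m l → 1 ≤ l
  at-least-1 zero w = ⊥-elim (m≢n (sym (walk-length-0 w)))
  at-least-1 (suc _) _ = s≤s z≤n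
... | no m≢n | no n≁m =
  step (n∈X , 1∈X , n≢1 , inj₂ (1∣ n)) (step (1∈X , m∈X , 1≢m , inj₁ (1∣ m)) (here 1≤m m≤N)) ,
  at-least-2
  where
  n∈X : 1 ≤ n × n ≤ N
  n∈X = 1≤n , n≤N
  m∈X : 1 ≤ m × m ≤ N
  m∈X = 1≤m , m≤N
  1∈X : 1 ≤ 1 × 1 ≤ N
  1∈X = s≤s z≤n , ≤-trans 1≤n n≤N
  n≢1 : n ≢ 1
  n≢1 refl = n≁m ((λ 1≡m → m≢n (sym 1≡m)) , inj₁ (1∣ m))
  1≢m : 1 ≢ m
  1≢m refl = n≁m ((λ n≡1 → m≢n (sym n≡1)) , inj₂ (1∣ n))
  at-least-2 : ∀ l → Walk N n m l → 2 ≤ l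
  at-least-2 zero w = ⊥-elim (m≢n (sym (walk-length-0 w)))
  at-least-2 (suc zero) w = ⊥-elim (n≁m (walk-length-1 w))
  at-least-2 (suc (suc _)) _ = s≤s (s≤s z≤n)

add-contribution : ∀ a b c {s k c′ l} → a + b + 2 * c ≡ 2 → s + k + 2 * c′ ≡ 2 * l →
                   a + s + (b + k) + 2 * (c + c′) ≡ 2 * suc l
add-contribution a b c {s} {k} {c′} {l} a+b+2c≡2 s+k+2c′≡2l = begin
  a + s + (b + k) + 2 * (c + c′)        ≡⟨ regroup a b c s k c′ ⟩
  (a + b + 2 * c) + (s + k + 2 * c′)    ≡⟨ cong₂ _+_ a+b+2c≡2 s+k+2c′≡2l ⟩
  2 + 2 * l                             ≡⟨ *-suc 2 l ⟨
  2 * suc l                             ∎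
  where
  open ≡-Reasoning
  regroup : ∀ a b c s k c′ → a + s + (b + k) + 2 * (c + c′) ≡ (a + b + 2 * c) + (s + k + 2 * c′)
  regroup = solve-∀

distFrom-contribution : ∀ n m →
  distFrom n m + length (filter (divAdj? n) [ m ]) + 2 * length (filter (_≟ n) [ m ]) ≡ 2
distFrom-contribution n m with m ≟ n | divAdj? n m
... | yes refl | yes (n≢n , _) = ⊥-elim (n≢n refl)
... | yes m≡n | no n≁m = cong₂ (λ ks cs → 0 + length ks + 2 * length cs)
  (filter-reject (divAdj? n) n≁m) (filter-accept (_≟ n) m≡n)
... | no m≢n | yes n~m = cong₂ (λ ks cs → 1 + length ks + 2 * length cs)
  (filter-accept (divAdj? n) n~m) (filter-reject (_≟ n) m≢n)
... | no m≢n | no n≁m = cong₂ (λ ks cs → 2 + length ks + 2 * length cs)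
  (filter-reject (divAdj? n) n≁m) (filter-reject (_≟ n) m≢n)

sum-distFrom : ∀ n L →
  sum (map (distFrom n) L) + length (filter (divAdj? n) L) + 2 * length (filter (_≟ n) L) ≡ 2 * length L
sum-distFrom n [] = refl
sum-distFrom n (m ∷ L) = begin
  sum (map (distFrom n) (m ∷ L)) + length (filter (divAdj? n) (m ∷ L)) + 2 * length (filter (_≟ n) (m ∷ L))
    ≡⟨ cong₂ (λ k c → distFrom n m + sum (map (distFrom n) L) + k + 2 * c) (split (divAdj? n)) (split (_≟ n)) ⟩
  distFrom n m + sum (map (distFrom n) L)
    + (length (filter (divAdj? n) [ m ]) + length (filter (divAdj? n) L))
    + 2 * (length (filter (_≟ n) [ m ]) + length (filter (_≟ n) L))
    ≡⟨ add-contribution (distFrom n m) (length (filter (divAdj? n) [ m ])) (length (filter (_≟ n) [ m ])) (distFrom-contribution n m) (sum-distFrom n L) ⟩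
  2 * length (m ∷ L) ∎
  where
  open ≡-Reasoning
  split : ∀ {P : ℕ → Set} (P? : Decidable P) → length (filter P? (m ∷ L)) ≡ length (filter P? [ m ]) + length (filter P? L)
  split P? = trans (cong length (filter-++ P? [ m ] L)) (length-++ (filter P? [ m ]))

sum-distFrom-X : ∀ N {n} → 1 ≤ n → n ≤ N → sum (map (distFrom n) (X N)) + degree N n + 2 ≡ 2 * N
sum-distFrom-X N {n} 1≤n n≤N = begin
  sum (map (distFrom n) (X N)) + degree N n + 2
    ≡⟨ cong (λ c → sum (map (distFrom n) (X N)) + degree N n + 2 * c) (sym (length-filter-≟-X N 1≤n n≤N)) ⟩
  sum (map (distFrom n) (X N)) + degree N n + 2 * length (filter (_≟ n) (X N))
    ≡⟨ sum-distFrom n (X N) ⟩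
  2 * length (X N)
    ≡⟨ cong (2 *_) (length-X N) ⟩
  2 * N ∎
  where open ≡-Reasoning

sum≡⇒pos-sub-sub : ∀ {s k t} → s + k + 2 ≡ t → + s ≡ (+ t - + k) - + 2
sum≡⇒pos-sub-sub {s} {k} refl = begin
  + s                                ≡⟨ add-sub-cancel (+ s) (+ k) (+ 2) ⟩
  ((+ s +ℤ + k +ℤ + 2) - + k) - + 2    ≡⟨ cong (λ z → (z - + k) - + 2) pos-sum ⟨
  (+ (s + k + 2) - + k) - + 2          ∎
  where
  open ≡-Reasoning
  add-sub-cancel : ∀ x y z → x ≡ ((x +ℤ y +ℤ z) - y) - z
  add-sub-cancel = ℤ.solve-∀
  pos-sum : + (s + k + 2) ≡ + s +ℤ + k +ℤ + 2
  pos-sum = trans (pos-+ (s + k) 2) (cong (_+ℤ + 2) (pos-+ s k))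

theorem3 : (N : ℕ) .{{_ : NonZero N}} (n : ℕ) → 1 ≤ n → n ≤ N →
    ∃ (λ d → IsGeodesicDist N n d)
    × (∀ d → IsGeodesicDist N n d → meanDist N d ≡ formula N n)
theorem3 N n 1≤n n≤N = (distFrom n , geodesic) , mean-distance
  where
  geodesic : IsGeodesicDist N n (distFrom n)
  geodesic = distFrom-geodesic 1≤n n≤N
  mean-distance : ∀ d → IsGeodesicDist N n d → meanDist N d ≡ formula N n
  mean-distance d d-geodesic = cong (_/ N) (begin
    + sum (map d (X N))              ≡⟨ cong (λ ds → + sum ds) (map-cong-local agree) ⟩
    + sum (map (distFrom n) (X N))   ≡⟨ sum≡⇒pos-sub-sub (sum-distFrom-X N 1≤n n≤N) ⟩
    (+ (2 * N) - + degree N n) - + 2 ∎)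
    where
    open ≡-Reasoning
    agree : All (λ m → d m ≡ distFrom n m) (X N)
    agree = All.map (λ (1≤m , m≤N) → geodesic-unique d-geodesic geodesic 1≤m m≤N) (All-X N)
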